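{- Let $P(z,w)$ be the unique formal power series with $P=1+\frac{wzP^2}{1-z^3P^2}$. For every positive integer $e$, $$P(z,w)^e=1+\sum_{\substack{n,k\in\mathbb Z:\\0\le k<n/3}}\frac{e}{n-k+e}\binom{n-2k-1}{k}\binom{2n-4k+e-1}{n-3k}z^nw^{n-3k}.$$ -}

module Defs where

open import Data.Nat as ℕ using (ℕ; zero; suc; _∸_; _<?_; _≟_)
open import Data.Nat.Combinatorics using (_C_)
open import Data.Integer using (+_)
open import Data.Rational using (ℚ; 0ℚ; 1ℚ; _/_; _+_; _*_; _-_)
open import Relation.Binary.PropositionalEquality using (_≡_)
open import Relation.Nullary using (yes; no)

ℕ→ℚ : ℕ → ℚ
ℕ→ℚ n = + n / 1

-- a / d as a rational (convention: value 0 when d = 0; never used with d = 0 below).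
frac : ℕ → ℕ → ℚ
frac a zero    = 0ℚ
frac a (suc d) = + a / suc d

sumTo : ℕ → (ℕ → ℚ) → ℚ
sumTo zero    h = h 0
sumTo (suc n) h = sumTo n h + h (suc n)

-- Formal power series in z, w over ℚ: S i j is the coefficient of z^i w^j.
Series : Set
Series = ℕ → ℕ → ℚ

_≈ₛ_ : Series → Series → Set
F ≈ₛ G = ∀ i j → F i j ≡ G i j
infix 4 _≈ₛ_

oneₛ : Series
oneₛ zero zero = 1ℚ
oneₛ _    _    = 0ℚ

zₛ : Series
zₛ 1 zero = 1ℚ
zₛ _ _    = 0ℚ

wₛ : Series
wₛ zero 1 = 1ℚ
wₛ _    _ = 0ℚ

_+ₛ_ : Series → Series → Series
(F +ₛ G) i j = F i j + G i j

_-ₛ_ : Series → Series → Series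
(F -ₛ G) i j = F i j - G i j

_*ₛ_ : Series → Series → Series
(F *ₛ G) i j = sumTo i λ a → sumTo j λ b → F a b * G (i ∸ a) (j ∸ b)

infixl 6 _+ₛ_ _-ₛ_
infixl 7 _*ₛ_

_^ₛ_ : Series → ℕ → Series
F ^ₛ zero  = oneₛ
F ^ₛ suc e = F *ₛ (F ^ₛ e)

infixr 8 _^ₛ_

-- Coefficient of z^n w^m in
--   1 + Σ_{0 ≤ k < n/3} e/(n-k+e) C(n-2k-1,k) C(2n-4k+e-1,n-3k) z^n w^(n-3k).
-- (k ranges over 0..n; the condition k < n/3 is 3k < n.)
rhsTerm : ℕ → ℕ → ℕ → ℕ → ℚ
rhsTerm e n m k with 3 ℕ.* k <? n | m ≟ n ∸ 3 ℕ.* k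
... | yes _ | yes _ =
  frac e (n ∸ k ℕ.+ e)
  * ℕ→ℚ (((n ∸ 2 ℕ.* k) ∸ 1) C k)
  * ℕ→ℚ ((((2 ℕ.* n ∸ 4 ℕ.* k) ℕ.+ e) ∸ 1) C (n ∸ 3 ℕ.* k))
... | _     | _     = 0ℚ

rhs : ℕ → Series
rhs e n m = oneₛ n m + sumTo n (rhsTerm e n m)

-- Write Bₑ = Pᵉ Q. The hypotheses give P^(e+1) = Pᵉ + zw B_(e+2) and, since
-- Q = 1 + Q z³ P², Bₑ = Pᵉ + z³ B_(e+2); together with P⁰ = 1 these recurrences
-- determine every coefficient of every Pᵉ and Bₑ by induction on the degree in z.
-- So it is enough to check that the right-hand sides Rₑ satisfy them, with B_(f+2)
-- replaced by the series forced by the first recurrence,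
-- D_f(n, m) = R_(f+1)(n+1, m+1) − R_f(n+1, m+1). All these series live on the
-- exponents (m + 3k, m), and once the denominator n − k + e is cleared from the
-- coefficients, the second recurrence becomes a consequence of Pascal's rule.

module Submission where

open import Defs
open import Algebra.Bundles using (CommutativeMonoid)
open import Algebra.Structures using (IsCommutativeMonoid)
import Algebra.Solver.CommutativeMonoid
open import Data.Empty using (⊥-elim)
open import Data.Fin.Patterns using (0F; 1F; 2F; 3F; 4F)
import Data.Integer as ℤ
import Data.Integer.Properties as ℤ
open import Data.Nat as ℕ using (ℕ; zero; suc; z≤n; s≤s; _∸_; _<_; _<?_; _≟_; _≤?_; NonZero)
open import Data.Nat.Combinatorics using (_C_; nCk+nC[k+1]≡[n+1]C[k+1]; nCn≡1; nC1≡n; k>n⇒nCk≡0; nCk≡nPk/k!)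
import Data.Nat.Coprimality as Coprime
open import Data.Nat.Divisibility using (_∣?_; divides)
open import Data.Nat.Induction using (<-rec)
import Data.Nat.Properties as ℕ
import Data.Nat.Solver
open import Data.Product using (_×_; _,_; proj₁; proj₂; ∃-syntax)
open import Data.Rational using (ℚ; 0ℚ; 1ℚ; _+_; _*_; _-_; _/_; mkℚ; toℚᵘ)
import Data.Rational.Properties as ℚ
import Data.Rational.Solver
import Data.Rational.Unnormalised as ℚᵘ
import Data.Rational.Unnormalised.Properties as ℚᵘ
open import Data.Vec using ([]; _∷_)
open import Relation.Binary.Bundles using (Setoid)
open import Relation.Binary.Structures using (IsEquivalence)
open import Relation.Binary.PropositionalEquality
import Relation.Binary.Reasoning.Setoid as SetoidReasoning
open import Relation.Nullary using (Dec; yes; no; ¬_)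

module ℕ-Solver = Data.Nat.Solver.+-*-Solver
module ℚ-Solver = Data.Rational.Solver.+-*-Solver

ℕ→ℚ≡mkℚ : ∀ n → ℕ→ℚ n ≡ mkℚ (ℤ.+ n) 0 (Coprime.sym (Coprime.1-coprimeTo n))
ℕ→ℚ≡mkℚ n = ℚ.normalize-coprime (Coprime.sym (Coprime.1-coprimeTo n))

ℕ→ℚ-+ : ∀ m n → ℕ→ℚ (m ℕ.+ n) ≡ ℕ→ℚ m + ℕ→ℚ n
ℕ→ℚ-+ m n = sym (trans (cong₂ _+_ (ℕ→ℚ≡mkℚ m) (ℕ→ℚ≡mkℚ n))
  (cong (_/ 1) (cong₂ ℤ._+_ (ℤ.*-identityʳ (ℤ.+ m)) (ℤ.*-identityʳ (ℤ.+ n)))))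

ℕ→ℚ-* : ∀ m n → ℕ→ℚ (m ℕ.* n) ≡ ℕ→ℚ m * ℕ→ℚ n
ℕ→ℚ-* m n = sym (trans (cong₂ _*_ (ℕ→ℚ≡mkℚ m) (ℕ→ℚ≡mkℚ n))
  (cong (_/ 1) (sym (ℤ.pos-* m n))))

ℕ→ℚ-*-≡ : ∀ a b c d → a ℕ.* b ≡ c ℕ.* d → ℕ→ℚ a * ℕ→ℚ b ≡ ℕ→ℚ c * ℕ→ℚ d
ℕ→ℚ-*-≡ a b c d eq = trans (sym (ℕ→ℚ-* a b)) (trans (cong ℕ→ℚ eq) (ℕ→ℚ-* c d))

frac*denominator : ∀ a d → frac a (suc d) * ℕ→ℚ (suc d) ≡ ℕ→ℚ a
frac*denominator a d = ℚ.toℚᵘ-injective (begin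
  toℚᵘ (frac a (suc d) * ℕ→ℚ (suc d))
    ≈⟨ ℚ.toℚᵘ-homo-* (frac a (suc d)) (ℕ→ℚ (suc d)) ⟩
  toℚᵘ (frac a (suc d)) ℚᵘ.* toℚᵘ (ℕ→ℚ (suc d))
    ≈⟨ ℚᵘ.*-cong (ℚ.toℚᵘ-fromℚᵘ (ℚᵘ.mkℚᵘ (ℤ.+ a) d)) (ℚ.toℚᵘ-fromℚᵘ (ℚᵘ.mkℚᵘ (ℤ.+ suc d) 0)) ⟩
  ℚᵘ.mkℚᵘ (ℤ.+ a) d ℚᵘ.* ℚᵘ.mkℚᵘ (ℤ.+ suc d) 0
    ≈⟨ ℚᵘ.*≡* cross ⟩
  ℚᵘ.mkℚᵘ (ℤ.+ a) 0
    ≈⟨ ℚᵘ.≃-sym (ℚ.toℚᵘ-fromℚᵘ (ℚᵘ.mkℚᵘ (ℤ.+ a) 0)) ⟩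
  toℚᵘ (ℕ→ℚ a) ∎)
  where
  open ℚᵘ.≃-Reasoning
  cross : (ℤ.+ a ℤ.* ℤ.+ suc d) ℤ.* ℤ.+ 1 ≡ ℤ.+ a ℤ.* ℤ.+ (suc d ℕ.* 1)
  cross = trans (ℤ.*-identityʳ _) (cong (λ x → ℤ.+ a ℤ.* ℤ.+ x) (sym (ℕ.*-identityʳ (suc d))))

*-cancelˡ-ℕ→ℚ-suc : ∀ d {x y} → ℕ→ℚ (suc d) * x ≡ ℕ→ℚ (suc d) * y → x ≡ y
*-cancelˡ-ℕ→ℚ-suc d {x} {y} eq = begin
  x             ≡⟨ sym (ℚ.*-identityˡ x) ⟩
  1ℚ * x        ≡⟨ cong (_* x) (sym (frac*denominator 1 d)) ⟩
  (i * s) * x   ≡⟨ ℚ.*-assoc i s x ⟩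
  i * (s * x)   ≡⟨ cong (i *_) eq ⟩
  i * (s * y)   ≡⟨ ℚ.*-assoc i s y ⟨
  (i * s) * y   ≡⟨ cong (_* y) (frac*denominator 1 d) ⟩
  1ℚ * y        ≡⟨ ℚ.*-identityˡ y ⟩
  y             ∎
  where
  open ≡-Reasoning
  i = frac 1 (suc d); s = ℕ→ℚ (suc d)

[1+d]*y≡a*x⇒frac*x≡y : ∀ a d {x y} → ℕ→ℚ (suc d) * y ≡ ℕ→ℚ a * x → frac a (suc d) * x ≡ y
[1+d]*y≡a*x⇒frac*x≡y a d {x} {y} eq = *-cancelˡ-ℕ→ℚ-suc d (begin
  s * (f * x)   ≡⟨ solve 3 (λ s f x → s :* (f :* x) := (f :* s) :* x) refl s f x ⟩
  (f * s) * x   ≡⟨ cong (_* x) (frac*denominator a d) ⟩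
  ℕ→ℚ a * x     ≡⟨ eq ⟨
  s * y         ∎)
  where
  open ≡-Reasoning
  open ℚ-Solver
  f = frac a (suc d); s = ℕ→ℚ (suc d)

-- Finite sums

sumTo-cong-≤ : ∀ n {f g : ℕ → ℚ} → (∀ {i} → i ℕ.≤ n → f i ≡ g i) → sumTo n f ≡ sumTo n g
sumTo-cong-≤ zero    eq = eq z≤n
sumTo-cong-≤ (suc n) eq = cong₂ _+_ (sumTo-cong-≤ n (λ i≤n → eq (ℕ.m≤n⇒m≤1+n i≤n))) (eq ℕ.≤-refl)

sumTo-cong : ∀ n {f g : ℕ → ℚ} → (∀ i → f i ≡ g i) → sumTo n f ≡ sumTo n g
sumTo-cong n eq = sumTo-cong-≤ n (λ {i} _ → eq i)

sumTo-zero : ∀ n {f : ℕ → ℚ} → (∀ {i} → i ℕ.≤ n → f i ≡ 0ℚ) → sumTo n f ≡ 0ℚ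
sumTo-zero zero    eq = eq z≤n
sumTo-zero (suc n) eq = cong₂ _+_ (sumTo-zero n (λ i≤n → eq (ℕ.m≤n⇒m≤1+n i≤n))) (eq ℕ.≤-refl)

sumTo-*-zeroˡ : ∀ j (f g : ℕ → ℚ) → (∀ b → f b ≡ 0ℚ) → sumTo j (λ b → f b * g b) ≡ 0ℚ
sumTo-*-zeroˡ j f g f≡0 = sumTo-zero j (λ {b} _ → trans (cong (_* g b) (f≡0 b)) (ℚ.*-zeroˡ (g b)))

sumTo-single : ∀ n k {f : ℕ → ℚ} → k ℕ.≤ n → (∀ {i} → i ℕ.≤ n → i ≢ k → f i ≡ 0ℚ) → sumTo n f ≡ f k
sumTo-single zero zero z≤n _ = refl
sumTo-single (suc n) k {f} k≤1+n others with k ℕ.≟ suc n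
... | yes refl = trans (cong (_+ f (suc n)) (sumTo-zero n (λ i≤n → others (ℕ.m≤n⇒m≤1+n i≤n) (ℕ.<⇒≢ (s≤s i≤n)))))
                       (ℚ.+-identityˡ (f (suc n)))
... | no k≢1+n = trans (cong₂ _+_ (sumTo-single n k (ℕ.≤-pred (ℕ.≤∧≢⇒< k≤1+n k≢1+n)) (λ i≤n → others (ℕ.m≤n⇒m≤1+n i≤n)))
                                  (others ℕ.≤-refl (≢-sym k≢1+n)))
                       (ℚ.+-identityʳ (f k))

sumTo-+ : ∀ n (f g : ℕ → ℚ) → sumTo n (λ i → f i + g i) ≡ sumTo n f + sumTo n g
sumTo-+ zero    f g = refl
sumTo-+ (suc n) f g = trans (cong (_+ (f (suc n) + g (suc n))) (sumTo-+ n f g))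
  (solve 4 (λ a b c d → (a :+ b) :+ (c :+ d) := (a :+ c) :+ (b :+ d)) refl (sumTo n f) (sumTo n g) (f (suc n)) (g (suc n)))
  where open ℚ-Solver

sumTo-- : ∀ n (f g : ℕ → ℚ) → sumTo n (λ i → f i - g i) ≡ sumTo n f - sumTo n g
sumTo-- zero    f g = refl
sumTo-- (suc n) f g = trans (cong (_+ (f (suc n) - g (suc n))) (sumTo-- n f g))
  (solve 4 (λ a b c d → (a :- b) :+ (c :- d) := (a :+ c) :- (b :+ d)) refl (sumTo n f) (sumTo n g) (f (suc n)) (g (suc n)))
  where open ℚ-Solver

sumTo-*ˡ : ∀ n c (f : ℕ → ℚ) → sumTo n (λ i → c * f i) ≡ c * sumTo n f
sumTo-*ˡ zero    c f = refl
sumTo-*ˡ (suc n) c f = trans (cong (_+ c * f (suc n)) (sumTo-*ˡ n c f)) (sym (ℚ.*-distribˡ-+ c (sumTo n f) (f (suc n))))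

sumTo-*ʳ : ∀ n c (f : ℕ → ℚ) → sumTo n (λ i → f i * c) ≡ sumTo n f * c
sumTo-*ʳ zero    c f = refl
sumTo-*ʳ (suc n) c f = trans (cong (_+ f (suc n) * c) (sumTo-*ʳ n c f)) (sym (ℚ.*-distribʳ-+ c (sumTo n f) (f (suc n))))

sumTo-suc-head : ∀ n (f : ℕ → ℚ) → sumTo (suc n) f ≡ f 0 + sumTo n (λ i → f (suc i))
sumTo-suc-head zero    f = refl
sumTo-suc-head (suc n) f = trans (cong (_+ f (suc (suc n))) (sumTo-suc-head n f))
                                 (ℚ.+-assoc (f 0) (sumTo n (λ i → f (suc i))) (f (suc (suc n))))

sumTo-reverse : ∀ n (f : ℕ → ℚ) → sumTo n f ≡ sumTo n (λ i → f (n ∸ i))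
sumTo-reverse zero    f = refl
sumTo-reverse (suc n) f = begin
  sumTo n f + f (suc n)                       ≡⟨ ℚ.+-comm (sumTo n f) (f (suc n)) ⟩
  f (suc n) + sumTo n f                       ≡⟨ cong (f (suc n) +_) (sumTo-reverse n f) ⟩
  f (suc n) + sumTo n (λ i → f (n ∸ i))       ≡⟨ sumTo-suc-head n (λ i → f (suc n ∸ i)) ⟨
  sumTo (suc n) (λ i → f (suc n ∸ i))         ∎
  where open ≡-Reasoning

sumTo-swap : ∀ n m (f : ℕ → ℕ → ℚ) →
             sumTo n (λ a → sumTo m (f a)) ≡ sumTo m (λ b → sumTo n (λ a → f a b))
sumTo-swap zero    m f = refl
sumTo-swap (suc n) m f = trans (cong (_+ sumTo m (f (suc n))) (sumTo-swap n m f))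
                               (sym (sumTo-+ m (λ b → sumTo n (λ a → f a b)) (f (suc n))))

sumTo-triangle : ∀ n (g : ℕ → ℕ → ℚ) →
                 sumTo n (λ a → sumTo a (λ c → g c a)) ≡ sumTo n (λ c → sumTo (n ∸ c) (λ d → g c (c ℕ.+ d)))
sumTo-triangle zero    g = refl
sumTo-triangle (suc n) g = begin
  sumTo n (λ a → sumTo a (λ c → g c a)) + (sumTo n (λ c → g c (suc n)) + g (suc n) (suc n))
    ≡⟨ cong (_+ (sumTo n (λ c → g c (suc n)) + g (suc n) (suc n))) (sumTo-triangle n g) ⟩
  sumTo n rows + (sumTo n (λ c → g c (suc n)) + g (suc n) (suc n))
    ≡⟨ ℚ.+-assoc (sumTo n rows) _ _ ⟨
  (sumTo n rows + sumTo n (λ c → g c (suc n))) + g (suc n) (suc n)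
    ≡⟨ cong₂ _+_ (sym (sumTo-+ n rows (λ c → g c (suc n)))) (cong (g (suc n)) (sym (ℕ.+-identityʳ (suc n)))) ⟩
  sumTo n (λ c → rows c + g c (suc n)) + g (suc n) (suc n ℕ.+ 0)
    ≡⟨ cong₂ _+_ (sumTo-cong-≤ n extend-row)
                 (cong (λ t → sumTo t (λ d → g (suc n) (suc n ℕ.+ d))) (sym (ℕ.n∸n≡0 n))) ⟩
  sumTo n (λ c → sumTo (suc n ∸ c) (λ d → g c (c ℕ.+ d))) + sumTo (n ∸ n) (λ d → g (suc n) (suc n ℕ.+ d)) ∎
  where
  open ≡-Reasoning
  rows : ℕ → ℚ
  rows c = sumTo (n ∸ c) (λ d → g c (c ℕ.+ d))
  extend-row : ∀ {c} → c ℕ.≤ n → rows c + g c (suc n) ≡ sumTo (suc n ∸ c) (λ d → g c (c ℕ.+ d))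
  extend-row {c} c≤n =
    trans (cong (λ t → rows c + g c t) (sym (trans (ℕ.+-suc c (n ∸ c)) (cong suc (ℕ.m+[n∸m]≡n c≤n)))))
          (cong (λ t → sumTo t (λ d → g c (c ℕ.+ d))) (sym (ℕ.+-∸-assoc 1 c≤n)))

-- The algebra of series

≈ₛ-refl : ∀ {F} → F ≈ₛ F
≈ₛ-refl i j = refl

≈ₛ-trans : ∀ {F G H} → F ≈ₛ G → G ≈ₛ H → F ≈ₛ H
≈ₛ-trans F≈G G≈H i j = trans (F≈G i j) (G≈H i j)

≈ₛ-isEquivalence : IsEquivalence _≈ₛ_
≈ₛ-isEquivalence = record
  { refl  = ≈ₛ-refl
  ; sym   = λ F≈G i j → sym (F≈G i j)
  ; trans = ≈ₛ-trans
  }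

≈ₛ-setoid : Setoid _ _
≈ₛ-setoid = record { isEquivalence = ≈ₛ-isEquivalence }

+ₛ-cong : ∀ {F F′ G G′} → F ≈ₛ F′ → G ≈ₛ G′ → F +ₛ G ≈ₛ F′ +ₛ G′
+ₛ-cong F≈F′ G≈G′ i j = cong₂ _+_ (F≈F′ i j) (G≈G′ i j)

*ₛ-cong : ∀ {F F′ G G′} → F ≈ₛ F′ → G ≈ₛ G′ → F *ₛ G ≈ₛ F′ *ₛ G′
*ₛ-cong F≈F′ G≈G′ i j = sumTo-cong i (λ a → sumTo-cong j (λ b → cong₂ _*_ (F≈F′ a b) (G≈G′ (i ∸ a) (j ∸ b))))

*ₛ-comm : ∀ F G → F *ₛ G ≈ₛ G *ₛ F
*ₛ-comm F G i j = begin
  sumTo i (λ a → sumTo j (λ b → F a b * G (i ∸ a) (j ∸ b)))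
    ≡⟨ sumTo-reverse i _ ⟩
  sumTo i (λ a → sumTo j (λ b → F (i ∸ a) b * G (i ∸ (i ∸ a)) (j ∸ b)))
    ≡⟨ sumTo-cong-≤ i (λ {a} a≤i → trans (sumTo-reverse j _) (sumTo-cong-≤ j (λ {b} b≤j →
          trans (cong₂ (λ s t → F (i ∸ a) (j ∸ b) * G s t) (ℕ.m∸[m∸n]≡n a≤i) (ℕ.m∸[m∸n]≡n b≤j))
                (ℚ.*-comm (F (i ∸ a) (j ∸ b)) (G a b))))) ⟩
  sumTo i (λ a → sumTo j (λ b → G a b * F (i ∸ a) (j ∸ b))) ∎
  where open ≡-Reasoning

*ₛ-identityˡ : ∀ F → oneₛ *ₛ F ≈ₛ F
*ₛ-identityˡ F i j =
  trans (sumTo-single i 0 z≤n outer) (trans (sumTo-single j 0 z≤n inner) (ℚ.*-identityˡ (F i j)))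
  where
  outer : ∀ {a} → a ℕ.≤ i → a ≢ 0 → sumTo j (λ b → oneₛ a b * F (i ∸ a) (j ∸ b)) ≡ 0ℚ
  outer {zero}  _ a≢0 = ⊥-elim (a≢0 refl)
  outer {suc a} _ _   = sumTo-*-zeroˡ j (oneₛ (suc a)) (λ b → F (i ∸ suc a) (j ∸ b)) (λ b → refl)
  inner : ∀ {b} → b ℕ.≤ j → b ≢ 0 → oneₛ 0 b * F i (j ∸ b) ≡ 0ℚ
  inner {zero}  _ b≢0 = ⊥-elim (b≢0 refl)
  inner {suc b} _ _   = ℚ.*-zeroˡ (F i (j ∸ suc b))

*ₛ-identityʳ : ∀ F → F *ₛ oneₛ ≈ₛ F
*ₛ-identityʳ F = ≈ₛ-trans (*ₛ-comm F oneₛ) (*ₛ-identityˡ F)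

*ₛ-assoc : ∀ F G H → (F *ₛ G) *ₛ H ≈ₛ F *ₛ (G *ₛ H)
*ₛ-assoc F G H i j = begin
  sumTo i (λ a → sumTo j (λ b → sumTo a (λ c → sumTo b (λ d → F c d * G (a ∸ c) (b ∸ d))) * H (i ∸ a) (j ∸ b)))
    ≡⟨ sumTo-cong i (λ a → sumTo-cong j (λ b → trans (sym (sumTo-*ʳ a _ _))
         (sumTo-cong a (λ c → sym (sumTo-*ʳ b _ _))))) ⟩
  sumTo i (λ a → sumTo j (λ b → sumTo a (λ c → sumTo b (λ d → T a b c d))))
    ≡⟨ sumTo-cong i (λ a → sumTo-swap j a _) ⟩
  sumTo i (λ a → sumTo a (λ c → sumTo j (λ b → sumTo b (λ d → T a b c d))))
    ≡⟨ sumTo-triangle i (λ c a → sumTo j (λ b → sumTo b (λ d → T a b c d))) ⟩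
  sumTo i (λ c → sumTo (i ∸ c) (λ a → sumTo j (λ b → sumTo b (λ d → T (c ℕ.+ a) b c d))))
    ≡⟨ sumTo-cong i (λ c → sumTo-cong (i ∸ c) (λ a → sumTo-triangle j (λ d b → T (c ℕ.+ a) b c d))) ⟩
  sumTo i (λ c → sumTo (i ∸ c) (λ a → sumTo j (λ d → sumTo (j ∸ d) (λ b → T (c ℕ.+ a) (d ℕ.+ b) c d))))
    ≡⟨ sumTo-cong i (λ c → sumTo-swap (i ∸ c) j _) ⟩
  sumTo i (λ c → sumTo j (λ d → sumTo (i ∸ c) (λ a → sumTo (j ∸ d) (λ b → T (c ℕ.+ a) (d ℕ.+ b) c d))))
    ≡⟨ sumTo-cong i (λ c → sumTo-cong j (λ d → trans (sumTo-cong (i ∸ c) (λ a →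
          trans (sumTo-cong (j ∸ d) (λ b → reindex c d a b)) (sumTo-*ˡ (j ∸ d) (F c d) _)))
          (sumTo-*ˡ (i ∸ c) (F c d) _))) ⟩
  sumTo i (λ c → sumTo j (λ d → F c d * sumTo (i ∸ c) (λ a → sumTo (j ∸ d) (λ b → G a b * H (i ∸ c ∸ a) (j ∸ d ∸ b))))) ∎
  where
  open ≡-Reasoning
  T : ℕ → ℕ → ℕ → ℕ → ℚ
  T a b c d = F c d * G (a ∸ c) (b ∸ d) * H (i ∸ a) (j ∸ b)
  reindex : ∀ c d a b → T (c ℕ.+ a) (d ℕ.+ b) c d ≡ F c d * (G a b * H (i ∸ c ∸ a) (j ∸ d ∸ b))
  reindex c d a b = begin
    F c d * G (c ℕ.+ a ∸ c) (d ℕ.+ b ∸ d) * H (i ∸ (c ℕ.+ a)) (j ∸ (d ℕ.+ b))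
      ≡⟨ cong₂ (λ x y → F c d * G x y * H (i ∸ (c ℕ.+ a)) (j ∸ (d ℕ.+ b))) (ℕ.m+n∸m≡n c a) (ℕ.m+n∸m≡n d b) ⟩
    F c d * G a b * H (i ∸ (c ℕ.+ a)) (j ∸ (d ℕ.+ b))
      ≡⟨ cong₂ (λ x y → F c d * G a b * H x y) (sym (ℕ.∸-+-assoc i c a)) (sym (ℕ.∸-+-assoc j d b)) ⟩
    F c d * G a b * H (i ∸ c ∸ a) (j ∸ d ∸ b)
      ≡⟨ ℚ.*-assoc (F c d) (G a b) (H (i ∸ c ∸ a) (j ∸ d ∸ b)) ⟩
    F c d * (G a b * H (i ∸ c ∸ a) (j ∸ d ∸ b)) ∎

*ₛ-isCommutativeMonoid : IsCommutativeMonoid _≈ₛ_ _*ₛ_ oneₛ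
*ₛ-isCommutativeMonoid = record
  { isMonoid = record
    { isSemigroup = record
      { isMagma = record { isEquivalence = ≈ₛ-isEquivalence ; ∙-cong = *ₛ-cong }
      ; assoc   = *ₛ-assoc
      }
    ; identity = *ₛ-identityˡ , *ₛ-identityʳ
    }
  ; comm = *ₛ-comm
  }

*ₛ-commutativeMonoid : CommutativeMonoid _ _
*ₛ-commutativeMonoid = record { isCommutativeMonoid = *ₛ-isCommutativeMonoid }

module *ₛ-Solver = Algebra.Solver.CommutativeMonoid *ₛ-commutativeMonoid

*ₛ-distribˡ-+ₛ : ∀ F G H → F *ₛ (G +ₛ H) ≈ₛ F *ₛ G +ₛ F *ₛ H
*ₛ-distribˡ-+ₛ F G H i j = trans (sumTo-cong i (λ a →
    trans (sumTo-cong j (λ b → ℚ.*-distribˡ-+ (F a b) _ _)) (sumTo-+ j _ _)))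
  (sumTo-+ i _ _)

*ₛ-distribʳ-+ₛ : ∀ F G H → (G +ₛ H) *ₛ F ≈ₛ G *ₛ F +ₛ H *ₛ F
*ₛ-distribʳ-+ₛ F G H = ≈ₛ-trans (*ₛ-comm (G +ₛ H) F)
  (≈ₛ-trans (*ₛ-distribˡ-+ₛ F G H) (+ₛ-cong (*ₛ-comm F G) (*ₛ-comm F H)))

*ₛ-distribˡ--ₛ : ∀ F G H → F *ₛ (G -ₛ H) ≈ₛ F *ₛ G -ₛ F *ₛ H
*ₛ-distribˡ--ₛ F G H i j = trans (sumTo-cong i (λ a → trans (sumTo-cong j (λ b →
    solve 3 (λ f g h → f :* (g :- h) := f :* g :- f :* h) refl (F a b) (G (i ∸ a) (j ∸ b)) (H (i ∸ a) (j ∸ b))))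
    (sumTo-- j _ _)))
  (sumTo-- i _ _)
  where open ℚ-Solver

^ₛ-+ : ∀ F a b → F ^ₛ a *ₛ F ^ₛ b ≈ₛ F ^ₛ (a ℕ.+ b)
^ₛ-+ F zero    b = *ₛ-identityˡ (F ^ₛ b)
^ₛ-+ F (suc a) b = ≈ₛ-trans (*ₛ-assoc F (F ^ₛ a) (F ^ₛ b)) (*ₛ-cong (≈ₛ-refl {F}) (^ₛ-+ F a b))

z-shift : Series → Series
z-shift F zero    j = 0ℚ
z-shift F (suc i) j = F i j

w-shift : Series → Series
w-shift F i zero    = 0ℚ
w-shift F i (suc j) = F i j

z³-shift : Series → Series
z³-shift F = z-shift (z-shift (z-shift F))

z-shift-cong : ∀ {F G} → F ≈ₛ G → z-shift F ≈ₛ z-shift G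
z-shift-cong F≈G zero    j = refl
z-shift-cong F≈G (suc i) j = F≈G i j

w-shift-cong : ∀ {F G} → F ≈ₛ G → w-shift F ≈ₛ w-shift G
w-shift-cong F≈G i zero    = refl
w-shift-cong F≈G i (suc j) = F≈G i j

zₛ*ₛ≈z-shift : ∀ F → zₛ *ₛ F ≈ₛ z-shift F
zₛ*ₛ≈z-shift F zero    j = sumTo-*-zeroˡ j (zₛ 0) (λ b → F 0 (j ∸ b)) (λ b → refl)
zₛ*ₛ≈z-shift F (suc i) j =
  trans (sumTo-single (suc i) 1 (s≤s z≤n) outer) (trans (sumTo-single j 0 z≤n inner) (ℚ.*-identityˡ (F i j)))
  where
  outer : ∀ {a} → a ℕ.≤ suc i → a ≢ 1 → sumTo j (λ b → zₛ a b * F (suc i ∸ a) (j ∸ b)) ≡ 0ℚ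
  outer {zero}        _ _   = sumTo-*-zeroˡ j (zₛ 0) (λ b → F (suc i) (j ∸ b)) (λ b → refl)
  outer {suc zero}    _ a≢1 = ⊥-elim (a≢1 refl)
  outer {suc (suc a)} _ _   = sumTo-*-zeroˡ j (zₛ (suc (suc a))) (λ b → F (i ∸ suc a) (j ∸ b)) (λ b → refl)
  inner : ∀ {b} → b ℕ.≤ j → b ≢ 0 → zₛ 1 b * F i (j ∸ b) ≡ 0ℚ
  inner {zero}  _ b≢0 = ⊥-elim (b≢0 refl)
  inner {suc b} _ _   = ℚ.*-zeroˡ (F i (j ∸ suc b))

wₛ*ₛ≈w-shift : ∀ F → wₛ *ₛ F ≈ₛ w-shift F
wₛ*ₛ≈w-shift F i zero = trans (sumTo-single i 0 z≤n outer) (ℚ.*-zeroˡ (F i 0))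
  where
  outer : ∀ {a} → a ℕ.≤ i → a ≢ 0 → wₛ a 0 * F (i ∸ a) 0 ≡ 0ℚ
  outer {zero}  _ a≢0 = ⊥-elim (a≢0 refl)
  outer {suc a} _ _   = ℚ.*-zeroˡ (F (i ∸ suc a) 0)
wₛ*ₛ≈w-shift F i (suc j) =
  trans (sumTo-single i 0 z≤n outer) (trans (sumTo-single (suc j) 1 (s≤s z≤n) inner) (ℚ.*-identityˡ (F i j)))
  where
  outer : ∀ {a} → a ℕ.≤ i → a ≢ 0 → sumTo (suc j) (λ b → wₛ a b * F (i ∸ a) (suc j ∸ b)) ≡ 0ℚ
  outer {zero}  _ a≢0 = ⊥-elim (a≢0 refl)
  outer {suc a} _ _   = sumTo-*-zeroˡ (suc j) (wₛ (suc a)) (λ b → F (i ∸ suc a) (suc j ∸ b)) (λ b → refl)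
  inner : ∀ {b} → b ℕ.≤ suc j → b ≢ 1 → wₛ 0 b * F i (suc j ∸ b) ≡ 0ℚ
  inner {zero}        _ _   = ℚ.*-zeroˡ (F i (suc j))
  inner {suc zero}    _ b≢1 = ⊥-elim (b≢1 refl)
  inner {suc (suc b)} _ _   = ℚ.*-zeroˡ (F i (suc j ∸ suc (suc b)))

zₛ*ₛwₛ*ₛ≈z-shift-w-shift : ∀ {F G} → F ≈ₛ G → zₛ *ₛ (wₛ *ₛ F) ≈ₛ z-shift (w-shift G)
zₛ*ₛwₛ*ₛ≈z-shift-w-shift {F} F≈G =
  ≈ₛ-trans (zₛ*ₛ≈z-shift (wₛ *ₛ F)) (z-shift-cong (≈ₛ-trans (wₛ*ₛ≈w-shift F) (w-shift-cong F≈G)))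

zₛ³*ₛ≈z³-shift : ∀ {F G} → F ≈ₛ G → zₛ *ₛ (zₛ *ₛ (zₛ *ₛ F)) ≈ₛ z³-shift G
zₛ³*ₛ≈z³-shift {F} F≈G =
  ≈ₛ-trans (zₛ*ₛ≈z-shift (zₛ *ₛ (zₛ *ₛ F))) (z-shift-cong (≈ₛ-trans (zₛ*ₛ≈z-shift (zₛ *ₛ F))
    (z-shift-cong (≈ₛ-trans (zₛ*ₛ≈z-shift F) (z-shift-cong F≈G)))))

-- The recurrences

-- X e stands for Pᵉ and U e for P^(e+2) Q.
record SatisfiesRecurrences (X U : ℕ → Series) : Set where
  field
    power-zero : X 0 ≈ₛ oneₛ
    power-suc  : ∀ e → X (suc e) ≈ₛ X e +ₛ z-shift (w-shift (U e))
    companion  : ∀ e → U e ≈ₛ X (2 ℕ.+ e) +ₛ z³-shift (U (2 ℕ.+ e))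

z-shift-agree : ∀ n {F G : Series} → (∀ {i} → i < n → ∀ j → F i j ≡ G i j) → ∀ j → z-shift F n j ≡ z-shift G n j
z-shift-agree zero    _     j = refl
z-shift-agree (suc n) agree j = agree ℕ.≤-refl j

w-shift-agree : ∀ n {F G : Series} → (∀ j → F n j ≡ G n j) → ∀ j → w-shift F n j ≡ w-shift G n j
w-shift-agree n agree zero    = refl
w-shift-agree n agree (suc j) = agree j

recurrences-unique : ∀ {X U Y V} → SatisfiesRecurrences X U → SatisfiesRecurrences Y V → ∀ e → X e ≈ₛ Y e
recurrences-unique {X} {U} {Y} {V} sX sY e i = proj₁ (<-rec Agree agree-at i) e
  where
  module X = SatisfiesRecurrences sX
  module Y = SatisfiesRecurrences sY
  Agree : ℕ → Set
  Agree n = (∀ e j → X e n j ≡ Y e n j) × (∀ e j → U e n j ≡ V e n j)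
  agree-at : ∀ n → (∀ {n′} → n′ < n → Agree n′) → Agree n
  agree-at n below = powers , companions
    where
    powers : ∀ e j → X e n j ≡ Y e n j
    powers zero    j = trans (X.power-zero n j) (sym (Y.power-zero n j))
    powers (suc e) j = begin
      X (suc e) n j                          ≡⟨ X.power-suc e n j ⟩
      X e n j + z-shift (w-shift (U e)) n j  ≡⟨ cong₂ _+_ (powers e j) shifted ⟩
      Y e n j + z-shift (w-shift (V e)) n j  ≡⟨ Y.power-suc e n j ⟨
      Y (suc e) n j                          ∎
      where
      open ≡-Reasoning
      shifted : z-shift (w-shift (U e)) n j ≡ z-shift (w-shift (V e)) n j
      shifted = z-shift-agree n (λ {i} i<n → w-shift-agree i (proj₂ (below i<n) e)) j
    companions : ∀ e j → U e n j ≡ V e n j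
    companions e j = begin
      U e n j                                       ≡⟨ X.companion e n j ⟩
      X (2 ℕ.+ e) n j + z³-shift (U (2 ℕ.+ e)) n j  ≡⟨ cong₂ _+_ (powers (2 ℕ.+ e) j) shifted ⟩
      Y (2 ℕ.+ e) n j + z³-shift (V (2 ℕ.+ e)) n j  ≡⟨ Y.companion e n j ⟨
      V e n j                                       ∎
      where
      open ≡-Reasoning
      shifted : z³-shift (U (2 ℕ.+ e)) n j ≡ z³-shift (V (2 ℕ.+ e)) n j
      shifted = z-shift-agree n (λ i<n → z-shift-agree _ (λ i′<i → z-shift-agree _ (λ i″<i′ →
                  proj₂ (below (ℕ.<-trans i″<i′ (ℕ.<-trans i′<i i<n))) (2 ℕ.+ e)))) j

module _ (P Q : Series)
         (Q-inverse : Q *ₛ (oneₛ -ₛ zₛ ^ₛ 3 *ₛ P ^ₛ 2) ≈ₛ oneₛ)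
         (P-equation : P ≈ₛ oneₛ +ₛ wₛ *ₛ zₛ *ₛ P ^ₛ 2 *ₛ Q) where

  Q-equation : Q ≈ₛ oneₛ +ₛ Q *ₛ (zₛ ^ₛ 3 *ₛ P ^ₛ 2)
  Q-equation i j = begin
    Q i j                        ≡⟨ solve 2 (λ q x → q := (q :- x) :+ x) refl (Q i j) (QW i j) ⟩
    (Q i j - QW i j) + QW i j    ≡⟨ cong (_+ QW i j) Q-QW≡1 ⟩
    oneₛ i j + QW i j            ∎
    where
    open ≡-Reasoning
    open ℚ-Solver
    W  = zₛ ^ₛ 3 *ₛ P ^ₛ 2
    QW = Q *ₛ W
    Q-QW≡1 : Q i j - QW i j ≡ oneₛ i j
    Q-QW≡1 = trans (cong (_- QW i j) (sym (*ₛ-identityʳ Q i j)))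
                   (trans (sym (*ₛ-distribˡ--ₛ Q oneₛ W i j)) (Q-inverse i j))

  powers-satisfy-recurrences : SatisfiesRecurrences (P ^ₛ_) (λ e → P ^ₛ (2 ℕ.+ e) *ₛ Q)
  powers-satisfy-recurrences = record
    { power-zero = ≈ₛ-refl
    ; power-suc  = power-suc
    ; companion  = λ e → companion (2 ℕ.+ e)
    }
    where
    power-suc : ∀ d → P ^ₛ suc d ≈ₛ P ^ₛ d +ₛ z-shift (w-shift (P ^ₛ (2 ℕ.+ d) *ₛ Q))
    power-suc d = begin
      P *ₛ P ^ₛ d                                        ≈⟨ *ₛ-cong P-equation (≈ₛ-refl {P ^ₛ d}) ⟩
      (oneₛ +ₛ wₛ *ₛ zₛ *ₛ P ^ₛ 2 *ₛ Q) *ₛ P ^ₛ d          ≈⟨ *ₛ-distribʳ-+ₛ (P ^ₛ d) oneₛ _ ⟩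
      oneₛ *ₛ P ^ₛ d +ₛ wₛ *ₛ zₛ *ₛ P ^ₛ 2 *ₛ Q *ₛ P ^ₛ d  ≈⟨ +ₛ-cong (*ₛ-identityˡ (P ^ₛ d)) rearrange ⟩
      P ^ₛ d +ₛ zₛ *ₛ (wₛ *ₛ (P ^ₛ 2 *ₛ P ^ₛ d *ₛ Q))      ≈⟨ +ₛ-cong (≈ₛ-refl {P ^ₛ d})
                                                              (zₛ*ₛwₛ*ₛ≈z-shift-w-shift (*ₛ-cong (^ₛ-+ P 2 d) (≈ₛ-refl {Q}))) ⟩
      P ^ₛ d +ₛ z-shift (w-shift (P ^ₛ (2 ℕ.+ d) *ₛ Q))   ∎
      where
      open SetoidReasoning ≈ₛ-setoid
      open *ₛ-Solver using (prove; var; _⊕_)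
      rearrange : wₛ *ₛ zₛ *ₛ P ^ₛ 2 *ₛ Q *ₛ P ^ₛ d ≈ₛ zₛ *ₛ (wₛ *ₛ (P ^ₛ 2 *ₛ P ^ₛ d *ₛ Q))
      rearrange = prove 5 ((((var 0F ⊕ var 1F) ⊕ var 2F) ⊕ var 3F) ⊕ var 4F)
                          (var 1F ⊕ (var 0F ⊕ ((var 2F ⊕ var 4F) ⊕ var 3F)))
                          (wₛ ∷ zₛ ∷ P ^ₛ 2 ∷ Q ∷ P ^ₛ d ∷ [])
    companion : ∀ e → P ^ₛ e *ₛ Q ≈ₛ P ^ₛ e +ₛ z³-shift (P ^ₛ (2 ℕ.+ e) *ₛ Q)
    companion e = begin
      P ^ₛ e *ₛ Q                                            ≈⟨ *ₛ-cong (≈ₛ-refl {P ^ₛ e}) Q-equation ⟩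
      P ^ₛ e *ₛ (oneₛ +ₛ Q *ₛ (zₛ ^ₛ 3 *ₛ P ^ₛ 2))             ≈⟨ *ₛ-distribˡ-+ₛ (P ^ₛ e) oneₛ (Q *ₛ (zₛ ^ₛ 3 *ₛ P ^ₛ 2)) ⟩
      P ^ₛ e *ₛ oneₛ +ₛ P ^ₛ e *ₛ (Q *ₛ (zₛ ^ₛ 3 *ₛ P ^ₛ 2))  ≈⟨ +ₛ-cong (*ₛ-identityʳ (P ^ₛ e)) rearrange ⟩
      P ^ₛ e +ₛ zₛ *ₛ (zₛ *ₛ (zₛ *ₛ (P ^ₛ 2 *ₛ P ^ₛ e *ₛ Q)))  ≈⟨ +ₛ-cong (≈ₛ-refl {P ^ₛ e})
                                                                  (zₛ³*ₛ≈z³-shift (*ₛ-cong (^ₛ-+ P 2 e) (≈ₛ-refl {Q}))) ⟩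
      P ^ₛ e +ₛ z³-shift (P ^ₛ (2 ℕ.+ e) *ₛ Q)                ∎
      where
      open SetoidReasoning ≈ₛ-setoid
      open *ₛ-Solver using (prove; var; id; _⊕_)
      rearrange : P ^ₛ e *ₛ (Q *ₛ (zₛ ^ₛ 3 *ₛ P ^ₛ 2)) ≈ₛ zₛ *ₛ (zₛ *ₛ (zₛ *ₛ (P ^ₛ 2 *ₛ P ^ₛ e *ₛ Q)))
      rearrange = prove 4 (var 3F ⊕ (var 2F ⊕ ((var 0F ⊕ (var 0F ⊕ (var 0F ⊕ id))) ⊕ var 1F)))
                          (var 0F ⊕ (var 0F ⊕ (var 0F ⊕ ((var 1F ⊕ var 3F) ⊕ var 2F))))
                          (zₛ ∷ P ^ₛ 2 ∷ Q ∷ P ^ₛ e ∷ [])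

-- Binomial coefficients

nC0≡1 : ∀ n → n C 0 ≡ 1
nC0≡1 n = nCk≡nPk/k! {0} {n} z≤n

[1+k]*[1+n]C[1+k]≡[1+n]*nCk : ∀ n k → suc k ℕ.* (suc n C suc k) ≡ suc n ℕ.* (n C k)
[1+k]*[1+n]C[1+k]≡[1+n]*nCk zero zero = refl
[1+k]*[1+n]C[1+k]≡[1+n]*nCk zero (suc k) = begin
  suc (suc k) ℕ.* (1 C suc (suc k))  ≡⟨ cong (suc (suc k) ℕ.*_) (k>n⇒nCk≡0 {1} {suc (suc k)} (s≤s (s≤s z≤n))) ⟩
  suc (suc k) ℕ.* 0                  ≡⟨ ℕ.*-zeroʳ (suc (suc k)) ⟩
  0                                  ≡⟨ cong (1 ℕ.*_) (k>n⇒nCk≡0 {0} {suc k} (s≤s z≤n)) ⟨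
  1 ℕ.* (0 C suc k)                  ∎
  where open ≡-Reasoning
[1+k]*[1+n]C[1+k]≡[1+n]*nCk (suc n) zero = begin
  1 ℕ.* (suc (suc n) C 1)      ≡⟨ ℕ.*-identityˡ (suc (suc n) C 1) ⟩
  suc (suc n) C 1              ≡⟨ nC1≡n (suc (suc n)) ⟩
  suc (suc n)                  ≡⟨ ℕ.*-identityʳ (suc (suc n)) ⟨
  suc (suc n) ℕ.* 1            ≡⟨ cong (suc (suc n) ℕ.*_) (nC0≡1 (suc n)) ⟨
  suc (suc n) ℕ.* (suc n C 0)  ∎
  where open ≡-Reasoning
[1+k]*[1+n]C[1+k]≡[1+n]*nCk (suc n) (suc k) = begin
  suc (suc k) ℕ.* (suc (suc n) C suc (suc k))
    ≡⟨ cong (suc (suc k) ℕ.*_) (nCk+nC[k+1]≡[n+1]C[k+1] (suc n) (suc k)) ⟨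
  suc (suc k) ℕ.* (X ℕ.+ Y)
    ≡⟨ solve 3 (λ k x y → (con 2 :+ k) :* (x :+ y) := x :+ (con 1 :+ k) :* x :+ (con 2 :+ k) :* y) refl k X Y ⟩
  X ℕ.+ suc k ℕ.* X ℕ.+ suc (suc k) ℕ.* Y
    ≡⟨ cong₂ (λ a b → X ℕ.+ a ℕ.+ b) ([1+k]*[1+n]C[1+k]≡[1+n]*nCk n k) ([1+k]*[1+n]C[1+k]≡[1+n]*nCk n (suc k)) ⟩
  X ℕ.+ suc n ℕ.* (n C k) ℕ.+ suc n ℕ.* (n C suc k)
    ≡⟨ solve 4 (λ x n a b → x :+ (con 1 :+ n) :* a :+ (con 1 :+ n) :* b := x :+ (con 1 :+ n) :* (a :+ b)) refl X n (n C k) (n C suc k) ⟩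
  X ℕ.+ suc n ℕ.* (n C k ℕ.+ n C suc k)
    ≡⟨ cong (λ t → X ℕ.+ suc n ℕ.* t) (nCk+nC[k+1]≡[n+1]C[k+1] n k) ⟩
  suc (suc n) ℕ.* X ∎
  where
  open ≡-Reasoning
  open ℕ-Solver
  X = suc n C suc k
  Y = suc n C suc (suc k)

[1+k]*[k+r]C[1+k]≡r*[k+r]Ck : ∀ k r → suc k ℕ.* ((k ℕ.+ r) C suc k) ≡ r ℕ.* ((k ℕ.+ r) C k)
[1+k]*[k+r]C[1+k]≡r*[k+r]Ck k r = ℕ.+-cancelʳ-≡ (suc k ℕ.* (n C k)) _ _ (begin
  suc k ℕ.* (n C suc k) ℕ.+ suc k ℕ.* (n C k) ≡⟨ ℕ.*-distribˡ-+ (suc k) (n C suc k) (n C k) ⟨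
  suc k ℕ.* (n C suc k ℕ.+ n C k)             ≡⟨ cong (suc k ℕ.*_) (trans (ℕ.+-comm (n C suc k) (n C k)) (nCk+nC[k+1]≡[n+1]C[k+1] n k)) ⟩
  suc k ℕ.* (suc n C suc k)                   ≡⟨ [1+k]*[1+n]C[1+k]≡[1+n]*nCk n k ⟩
  suc n ℕ.* (n C k)                           ≡⟨ cong (ℕ._* (n C k)) (solve 2 (λ k r → con 1 :+ (k :+ r) := r :+ (con 1 :+ k)) refl k r) ⟩
  (r ℕ.+ suc k) ℕ.* (n C k)                   ≡⟨ ℕ.*-distribʳ-+ (n C k) r (suc k) ⟩
  r ℕ.* (n C k) ℕ.+ suc k ℕ.* (n C k)         ∎)
  where
  open ≡-Reasoning
  open ℕ-Solver
  n = k ℕ.+ r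

ℕ→ℚ-pascal : ∀ n k → ℕ→ℚ (suc n C suc k) ≡ ℕ→ℚ (n C k) + ℕ→ℚ (n C suc k)
ℕ→ℚ-pascal n k = trans (cong ℕ→ℚ (sym (nCk+nC[k+1]≡[n+1]C[k+1] n k))) (ℕ→ℚ-+ (n C k) (n C suc k))

-- The coefficients of the right-hand side

-- For n = 1 + m + 3k the coefficient of zⁿ w^(1+m) in rhs e is
-- e / weight · C(m + k, k) · C(top, 1 + m), where weight = n − k + e and
-- top = 2n − 4k + e − 1. coeff is its division-free form
-- (weight*coeff≡e*lower*C[top,1+m]), with lower′ m k = C(m + k, k − 1), zero for k = 0.
lower : ℕ → ℕ → ℕ
lower m k = (m ℕ.+ k) C k

lower′ : ℕ → ℕ → ℕ
lower′ m zero    = 0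
lower′ m (suc k) = (m ℕ.+ suc k) C k

weight : ℕ → ℕ → ℕ → ℕ
weight e m k = suc m ℕ.+ (k ℕ.+ k) ℕ.+ e

top : ℕ → ℕ → ℕ → ℕ
top e m k = suc (e ℕ.+ (m ℕ.+ m) ℕ.+ (k ℕ.+ k))

top≡m+weight : ∀ e m k → top e m k ≡ m ℕ.+ weight e m k
top≡m+weight = solve 3 (λ e m k → con 1 :+ (e :+ (m :+ m) :+ (k :+ k)) := m :+ ((con 1 :+ m) :+ (k :+ k) :+ e)) refl
  where open ℕ-Solver

top-suc-m : ∀ e m k → top e (suc m) k ≡ top (2 ℕ.+ e) m k
top-suc-m = solve 3 (λ e m k → con 1 :+ (e :+ ((con 1 :+ m) :+ (con 1 :+ m)) :+ (k :+ k))
                            := con 1 :+ ((con 2 :+ e) :+ (m :+ m) :+ (k :+ k))) refl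
  where open ℕ-Solver

top-suc-k : ∀ e m k → top e m (suc k) ≡ top (2 ℕ.+ e) m k
top-suc-k = solve 3 (λ e m k → con 1 :+ (e :+ (m :+ m) :+ ((con 1 :+ k) :+ (con 1 :+ k)))
                            := con 1 :+ ((con 2 :+ e) :+ (m :+ m) :+ (k :+ k))) refl
  where open ℕ-Solver

weight≡top-at-m=0 : ∀ e k → weight e 0 k ≡ top e 0 k
weight≡top-at-m=0 = solve 2 (λ e k → con 1 :+ (k :+ k) :+ e := con 1 :+ (e :+ con 0 :+ (k :+ k))) refl
  where open ℕ-Solver

[1+m]*C[top,1+m]≡weight*C[top,m] : ∀ e m k → suc m ℕ.* (top e m k C suc m) ≡ weight e m k ℕ.* (top e m k C m)
[1+m]*C[top,1+m]≡weight*C[top,m] e m k =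
  subst (λ n → suc m ℕ.* (n C suc m) ≡ weight e m k ℕ.* (n C m)) (sym (top≡m+weight e m k))
        ([1+k]*[k+r]C[1+k]≡r*[k+r]Ck m (weight e m k))

k*lower≡[1+m]*lower′ : ∀ m k → k ℕ.* lower m k ≡ suc m ℕ.* lower′ m k
k*lower≡[1+m]*lower′ m zero    = sym (ℕ.*-zeroʳ (suc m))
k*lower≡[1+m]*lower′ m (suc k) =
  subst (λ n → suc k ℕ.* (n C suc k) ≡ suc m ℕ.* (n C k)) k+[1+m]≡m+[1+k] ([1+k]*[k+r]C[1+k]≡r*[k+r]Ck k (suc m))
  where
  k+[1+m]≡m+[1+k] : k ℕ.+ suc m ≡ m ℕ.+ suc k
  k+[1+m]≡m+[1+k] = trans (ℕ.+-suc k m) (trans (cong suc (ℕ.+-comm k m)) (sym (ℕ.+-suc m k)))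

lower-pascal : ∀ m k → lower (suc m) (suc k) ≡ lower m (suc k) ℕ.+ lower (suc m) k
lower-pascal m k = begin
  suc (m ℕ.+ suc k) C suc k                        ≡⟨ nCk+nC[k+1]≡[n+1]C[k+1] (m ℕ.+ suc k) k ⟨
  (m ℕ.+ suc k) C k ℕ.+ (m ℕ.+ suc k) C suc k      ≡⟨ ℕ.+-comm ((m ℕ.+ suc k) C k) _ ⟩
  lower m (suc k) ℕ.+ (m ℕ.+ suc k) C k            ≡⟨ cong (λ n → lower m (suc k) ℕ.+ n C k) (ℕ.+-suc m k) ⟩
  lower m (suc k) ℕ.+ lower (suc m) k              ∎
  where open ≡-Reasoning

lower′-pascal : ∀ m k → lower′ (suc m) (suc k) ≡ lower′ m (suc k) ℕ.+ lower′ (suc m) k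
lower′-pascal m zero    = trans (nC0≡1 (suc m ℕ.+ 1)) (sym (cong (ℕ._+ 0) (nC0≡1 (m ℕ.+ 1))))
lower′-pascal m (suc k) = begin
  suc (m ℕ.+ suc (suc k)) C suc k                              ≡⟨ nCk+nC[k+1]≡[n+1]C[k+1] (m ℕ.+ suc (suc k)) k ⟨
  (m ℕ.+ suc (suc k)) C k ℕ.+ (m ℕ.+ suc (suc k)) C suc k      ≡⟨ ℕ.+-comm ((m ℕ.+ suc (suc k)) C k) _ ⟩
  lower′ m (suc (suc k)) ℕ.+ (m ℕ.+ suc (suc k)) C k           ≡⟨ cong (λ n → lower′ m (suc (suc k)) ℕ.+ n C k) (ℕ.+-suc m (suc k)) ⟩
  lower′ m (suc (suc k)) ℕ.+ lower′ (suc m) (suc k)            ∎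
  where open ≡-Reasoning

cleared : ℚ → ℚ → ℚ → ℚ → ℚ
cleared a b c₁ c₀ = a * (c₁ - c₀) - (b + b) * c₀

w*cleared≡e*a*c₁ : ∀ w j k e a b c₀ c₁ → j * c₁ ≡ w * c₀ → k * a ≡ j * b → w ≡ j + (k + k) + e →
              w * cleared a b c₁ c₀ ≡ e * (a * c₁)
w*cleared≡e*a*c₁ w j k e a b c₀ c₁ jc₁≡wc₀ ka≡jb w≡j+2k+e = begin
  w * (a * (c₁ - c₀) - (b + b) * c₀)
    ≡⟨ solve 5 (λ w a b c₀ c₁ → w :* (a :* (c₁ :- c₀) :- (b :+ b) :* c₀) := w :* a :* c₁ :- (a :+ b :+ b) :* (w :* c₀)) refl w a b c₀ c₁ ⟩
  w * a * c₁ - (a + b + b) * (w * c₀)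
    ≡⟨ cong (λ t → w * a * c₁ - (a + b + b) * t) jc₁≡wc₀ ⟨
  w * a * c₁ - (a + b + b) * (j * c₁)
    ≡⟨ solve 5 (λ w j a b c₁ → w :* a :* c₁ :- (a :+ b :+ b) :* (j :* c₁) := c₁ :* (w :* a :- j :* a :- (j :* b :+ j :* b))) refl w j a b c₁ ⟩
  c₁ * (w * a - j * a - (j * b + j * b))
    ≡⟨ cong (λ t → c₁ * (w * a - j * a - (t + t))) ka≡jb ⟨
  c₁ * (w * a - j * a - (k * a + k * a))
    ≡⟨ cong (λ t → c₁ * (t * a - j * a - (k * a + k * a))) w≡j+2k+e ⟩
  c₁ * ((j + (k + k) + e) * a - j * a - (k * a + k * a))
    ≡⟨ solve 5 (λ j k e a c₁ → c₁ :* ((j :+ (k :+ k) :+ e) :* a :- j :* a :- (k :* a :+ k :* a)) := e :* (a :* c₁)) refl j k e a c₁ ⟩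
  e * (a * c₁) ∎
  where
  open ≡-Reasoning
  open ℚ-Solver

cleared-+ᵃᵇ : ∀ a a′ b b′ c₁ c₀ → cleared (a + a′) (b + b′) c₁ c₀ ≡ cleared a b c₁ c₀ + cleared a′ b′ c₁ c₀
cleared-+ᵃᵇ = solve 6 (λ a a′ b b′ c₁ c₀ →
  (a :+ a′) :* (c₁ :- c₀) :- ((b :+ b′) :+ (b :+ b′)) :* c₀ :=
  (a :* (c₁ :- c₀) :- (b :+ b) :* c₀) :+ (a′ :* (c₁ :- c₀) :- (b′ :+ b′) :* c₀)) refl
  where open ℚ-Solver

cleared-+ᶜ : ∀ a b c₁ c₁′ c₀ c₀′ → cleared a b (c₁ + c₁′) (c₀ + c₀′) ≡ cleared a b c₁ c₀ + cleared a b c₁′ c₀′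
cleared-+ᶜ = solve 6 (λ a b c₁ c₁′ c₀ c₀′ →
  a :* ((c₁ :+ c₁′) :- (c₀ :+ c₀′)) :- (b :+ b) :* (c₀ :+ c₀′) :=
  (a :* (c₁ :- c₀) :- (b :+ b) :* c₀) :+ (a :* (c₁′ :- c₀′) :- (b :+ b) :* c₀′)) refl
  where open ℚ-Solver

coeff : ℕ → ℕ → ℕ → ℚ
coeff e m k = cleared (ℕ→ℚ (lower m k)) (ℕ→ℚ (lower′ m k)) (ℕ→ℚ (top e m k C suc m)) (ℕ→ℚ (top e m k C m))

weight*coeff≡e*lower*C[top,1+m] : ∀ e m k →
  ℕ→ℚ (weight e m k) * coeff e m k ≡ ℕ→ℚ e * (ℕ→ℚ (lower m k) * ℕ→ℚ (top e m k C suc m))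
weight*coeff≡e*lower*C[top,1+m] e m k =
  w*cleared≡e*a*c₁ (ℕ→ℚ (weight e m k)) (ℕ→ℚ (suc m)) (ℕ→ℚ k) (ℕ→ℚ e) (ℕ→ℚ (lower m k)) (ℕ→ℚ (lower′ m k))
              (ℕ→ℚ (top e m k C m)) (ℕ→ℚ (top e m k C suc m))
              (ℕ→ℚ-*-≡ (suc m) (top e m k C suc m) (weight e m k) (top e m k C m) ([1+m]*C[top,1+m]≡weight*C[top,m] e m k))
              (ℕ→ℚ-*-≡ k (lower m k) (suc m) (lower′ m k) (k*lower≡[1+m]*lower′ m k))
              (trans (ℕ→ℚ-+ (suc m ℕ.+ (k ℕ.+ k)) e)
                     (cong (_+ ℕ→ℚ e) (trans (ℕ→ℚ-+ (suc m) (k ℕ.+ k)) (cong (ℕ→ℚ (suc m) +_) (ℕ→ℚ-+ k k)))))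

coeff-m=0 : ∀ e k → coeff e 0 k ≡ ℕ→ℚ e
coeff-m=0 e k = *-cancelˡ-ℕ→ℚ-suc (k ℕ.+ k ℕ.+ e) (begin
  ℕ→ℚ w * coeff e 0 k                               ≡⟨ weight*coeff≡e*lower*C[top,1+m] e 0 k ⟩
  ℕ→ℚ e * (ℕ→ℚ (k C k) * ℕ→ℚ (top e 0 k C 1))     ≡⟨ cong₂ (λ a b → ℕ→ℚ e * (ℕ→ℚ a * ℕ→ℚ b)) (nCn≡1 k) (nC1≡n (top e 0 k)) ⟩
  ℕ→ℚ e * (1ℚ * ℕ→ℚ (top e 0 k))                   ≡⟨ cong (λ t → ℕ→ℚ e * (1ℚ * ℕ→ℚ t)) (weight≡top-at-m=0 e k) ⟨
  ℕ→ℚ e * (1ℚ * ℕ→ℚ w)                             ≡⟨ cong (ℕ→ℚ e *_) (ℚ.*-identityˡ (ℕ→ℚ w)) ⟩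
  ℕ→ℚ e * ℕ→ℚ w                                    ≡⟨ ℚ.*-comm (ℕ→ℚ e) (ℕ→ℚ w) ⟩
  ℕ→ℚ w * ℕ→ℚ e                                    ∎)
  where
  open ≡-Reasoning
  w = weight e 0 k

-- The coefficient of z^(m+3k) w^m in rhs e; on the axis m = 0 only the constant term survives.
coeff₀ : ℕ → ℕ → ℕ → ℚ
coeff₀ e zero    zero    = 1ℚ
coeff₀ e zero    (suc k) = 0ℚ
coeff₀ e (suc m) k       = coeff e m k

coeffΔ : ℕ → ℕ → ℕ → ℚ
coeffΔ f m k = coeff (suc f) m k - coeff f m k

coeffΔ↓ : ℕ → ℕ → ℕ → ℚ
coeffΔ↓ g m zero    = 0ℚ
coeffΔ↓ g m (suc k) = coeffΔ g m k

coeffΔ-m=0 : ∀ f k → coeffΔ f 0 k ≡ 1ℚ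
coeffΔ-m=0 f k = begin
  coeff (suc f) 0 k - coeff f 0 k  ≡⟨ cong₂ _-_ (trans (coeff-m=0 (suc f) k) (ℕ→ℚ-+ 1 f)) (coeff-m=0 f k) ⟩
  (1ℚ + ℕ→ℚ f) - ℕ→ℚ f              ≡⟨ solve 1 (λ x → (con 1ℚ :+ x) :- x := con 1ℚ) refl (ℕ→ℚ f) ⟩
  1ℚ                               ∎
  where
  open ≡-Reasoning
  open ℚ-Solver

-- top (1 + f) m k = 1 + top f m k, so Pascal's rule splits coeff (1 + f) into this term plus coeff f.
coeffΔ-suc-m : ∀ f m k → coeffΔ f (suc m) k ≡
  cleared (ℕ→ℚ (lower (suc m) k)) (ℕ→ℚ (lower′ (suc m) k)) (ℕ→ℚ (top f (suc m) k C suc m)) (ℕ→ℚ (top f (suc m) k C m))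
coeffΔ-suc-m f m k = begin
  cleared a b (ℕ→ℚ (suc N C suc (suc m))) (ℕ→ℚ (suc N C suc m)) - coeff f (suc m) k
    ≡⟨ cong₂ (λ c₁ c₀ → cleared a b c₁ c₀ - coeff f (suc m) k) (ℕ→ℚ-pascal N (suc m)) (ℕ→ℚ-pascal N m) ⟩
  cleared a b (ℕ→ℚ (N C suc m) + ℕ→ℚ (N C suc (suc m))) (ℕ→ℚ (N C m) + ℕ→ℚ (N C suc m)) - coeff f (suc m) k
    ≡⟨ cong (_- coeff f (suc m) k) (cleared-+ᶜ a b (ℕ→ℚ (N C suc m)) (ℕ→ℚ (N C suc (suc m))) (ℕ→ℚ (N C m)) (ℕ→ℚ (N C suc m))) ⟩
  (cleared a b (ℕ→ℚ (N C suc m)) (ℕ→ℚ (N C m)) + coeff f (suc m) k) - coeff f (suc m) k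
    ≡⟨ solve 2 (λ x y → (x :+ y) :- y := x) refl (cleared a b (ℕ→ℚ (N C suc m)) (ℕ→ℚ (N C m))) (coeff f (suc m) k) ⟩
  cleared a b (ℕ→ℚ (N C suc m)) (ℕ→ℚ (N C m)) ∎
  where
  open ≡-Reasoning
  open ℚ-Solver
  N = top f (suc m) k
  a = ℕ→ℚ (lower (suc m) k)
  b = ℕ→ℚ (lower′ (suc m) k)

coeffΔ-zero : ∀ f m → coeffΔ f m 0 ≡ coeff₀ (2 ℕ.+ f) m 0
coeffΔ-zero f zero    = coeffΔ-m=0 f 0
coeffΔ-zero f (suc m) = trans (coeffΔ-suc-m f m 0)
  (cong₂ (λ a N → cleared (ℕ→ℚ a) 0ℚ (ℕ→ℚ (N C suc m)) (ℕ→ℚ (N C m)))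
         (trans (nC0≡1 (suc m ℕ.+ 0)) (sym (nC0≡1 (m ℕ.+ 0)))) (top-suc-m f m 0))

coeffΔ-suc : ∀ f m k → coeffΔ f m (suc k) ≡ coeff₀ (2 ℕ.+ f) m (suc k) + coeffΔ (2 ℕ.+ f) m k
coeffΔ-suc f zero k = begin
  coeffΔ f 0 (suc k)              ≡⟨ coeffΔ-m=0 f (suc k) ⟩
  1ℚ                              ≡⟨ ℚ.+-identityˡ 1ℚ ⟨
  0ℚ + 1ℚ                         ≡⟨ cong (0ℚ +_) (coeffΔ-m=0 (2 ℕ.+ f) k) ⟨
  0ℚ + coeffΔ (2 ℕ.+ f) 0 k       ∎
  where open ≡-Reasoning
coeffΔ-suc f (suc m) k = begin
  coeffΔ f (suc m) (suc k)
    ≡⟨ coeffΔ-suc-m f m (suc k) ⟩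
  cleared (ℕ→ℚ (lower (suc m) (suc k))) (ℕ→ℚ (lower′ (suc m) (suc k))) c₁ c₀
    ≡⟨ cong₂ (λ a b → cleared a b c₁ c₀)
             (trans (cong ℕ→ℚ (lower-pascal m k)) (ℕ→ℚ-+ (lower m (suc k)) (lower (suc m) k)))
             (trans (cong ℕ→ℚ (lower′-pascal m k)) (ℕ→ℚ-+ (lower′ m (suc k)) (lower′ (suc m) k))) ⟩
  cleared (ℕ→ℚ (lower m (suc k)) + ℕ→ℚ (lower (suc m) k)) (ℕ→ℚ (lower′ m (suc k)) + ℕ→ℚ (lower′ (suc m) k)) c₁ c₀
    ≡⟨ cleared-+ᵃᵇ (ℕ→ℚ (lower m (suc k))) (ℕ→ℚ (lower (suc m) k)) (ℕ→ℚ (lower′ m (suc k))) (ℕ→ℚ (lower′ (suc m) k)) c₁ c₀ ⟩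
  cleared (ℕ→ℚ (lower m (suc k))) (ℕ→ℚ (lower′ m (suc k))) c₁ c₀
    + cleared (ℕ→ℚ (lower (suc m) k)) (ℕ→ℚ (lower′ (suc m) k)) c₁ c₀
    ≡⟨ cong₂ _+_ (cong (λ N → cleared (ℕ→ℚ (lower m (suc k))) (ℕ→ℚ (lower′ m (suc k))) (ℕ→ℚ (N C suc m)) (ℕ→ℚ (N C m)))
                       (top-suc-m f m (suc k)))
                 (trans (cong (λ N → cleared (ℕ→ℚ (lower (suc m) k)) (ℕ→ℚ (lower′ (suc m) k)) (ℕ→ℚ (N C suc m)) (ℕ→ℚ (N C m)))
                              (top-suc-k f (suc m) k))
                        (sym (coeffΔ-suc-m (2 ℕ.+ f) m k))) ⟩
  coeff (2 ℕ.+ f) m (suc k) + coeffΔ (2 ℕ.+ f) (suc m) k ∎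
  where
  open ≡-Reasoning
  c₁ = ℕ→ℚ (top f (suc m) (suc k) C suc m)
  c₀ = ℕ→ℚ (top f (suc m) (suc k) C m)

coeffΔ-recurrence : ∀ f m k → coeffΔ f m k ≡ coeff₀ (2 ℕ.+ f) m k + coeffΔ↓ (2 ℕ.+ f) m k
coeffΔ-recurrence f m zero    = trans (coeffΔ-zero f m) (sym (ℚ.+-identityʳ _))
coeffΔ-recurrence f m (suc k) = coeffΔ-suc f m k

OnSupport : ℕ → ℕ → Set
OnSupport n m = ∃[ k ] n ≡ m ℕ.+ 3 ℕ.* k

onSupport? : ∀ n m → Dec (OnSupport n m)
onSupport? n m with m ≤? n
... | no m≰n = no λ (k , n≡m+3k) → m≰n (subst (m ℕ.≤_) (sym n≡m+3k) (ℕ.m≤m+n m (3 ℕ.* k)))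
... | yes m≤n with 3 ∣? (n ∸ m)
...   | yes (divides k n∸m≡k*3) = yes (k , trans (sym (ℕ.m+[n∸m]≡n m≤n)) (cong (m ℕ.+_) (trans n∸m≡k*3 (ℕ.*-comm k 3))))
...   | no 3∤n∸m = no λ (k , n≡m+3k) →
          3∤n∸m (divides k (trans (cong (_∸ m) n≡m+3k) (trans (ℕ.m+n∸m≡n m (3 ℕ.* k)) (ℕ.*-comm 3 k))))

m+3[1+k]≡3+m+3k : ∀ m k → m ℕ.+ 3 ℕ.* suc k ≡ 3 ℕ.+ (m ℕ.+ 3 ℕ.* k)
m+3[1+k]≡3+m+3k = solve 2 (λ m k → m :+ con 3 :* (con 1 :+ k) := con 3 :+ (m :+ con 3 :* k)) refl
  where open ℕ-Solver

rhsTerm≡0 : ∀ e n m k → (3 ℕ.* k ℕ.< n → m ≡ n ∸ 3 ℕ.* k → rhsTerm e n m k ≡ 0ℚ) → rhsTerm e n m k ≡ 0ℚ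
rhsTerm≡0 e n m k on-diagonal with 3 ℕ.* k <? n | m ≟ n ∸ 3 ℕ.* k
... | yes 3k<n | yes m≡n∸3k = on-diagonal 3k<n m≡n∸3k
... | yes _    | no _       = refl
... | no _     | _          = refl

rhsTerm-on-diagonal : ∀ e n m k → 3 ℕ.* k ℕ.< n → m ≡ n ∸ 3 ℕ.* k → rhsTerm e n m k ≡
  frac e (n ∸ k ℕ.+ e) * ℕ→ℚ (((n ∸ 2 ℕ.* k) ∸ 1) C k) * ℕ→ℚ ((((2 ℕ.* n ∸ 4 ℕ.* k) ℕ.+ e) ∸ 1) C (n ∸ 3 ℕ.* k))
rhsTerm-on-diagonal e n m k 3k<n m≡n∸3k with 3 ℕ.* k <? n | m ≟ n ∸ 3 ℕ.* k
... | yes _    | yes _       = refl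
... | no 3k≮n  | _           = ⊥-elim (3k≮n 3k<n)
... | yes _    | no m≢n∸3k   = ⊥-elim (m≢n∸3k m≡n∸3k)

rhs-e=0 : rhs 0 ≈ₛ oneₛ
rhs-e=0 n m = trans (cong (oneₛ n m +_) (sumTo-zero n (λ {k} _ → rhsTerm≡0 0 n m k λ 3k<n m≡n∸3k →
    trans (rhsTerm-on-diagonal 0 n m k 3k<n m≡n∸3k) (frac-0*x*y (n ∸ k ℕ.+ 0) _ _))))
  (ℚ.+-identityʳ (oneₛ n m))
  where
  frac-0*x*y : ∀ d x y → frac 0 d * x * y ≡ 0ℚ
  frac-0*x*y zero    x y = trans (cong (_* y) (ℚ.*-zeroˡ x)) (ℚ.*-zeroˡ y)
  frac-0*x*y (suc d) x y = trans (cong (λ t → t * x * y) (ℚ.0/n≡0 (suc d))) (trans (cong (_* y) (ℚ.*-zeroˡ x)) (ℚ.*-zeroˡ y))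

rhs-m=0 : ∀ e n → rhs e n 0 ≡ oneₛ n 0
rhs-m=0 e n = trans (cong (oneₛ n 0 +_) (sumTo-zero n (λ {k} _ → rhsTerm≡0 e n 0 k λ 3k<n 0≡n∸3k →
    ⊥-elim (ℕ.<⇒≢ (ℕ.m<n⇒0<n∸m 3k<n) 0≡n∸3k))))
  (ℚ.+-identityʳ (oneₛ n 0))

rhs-n=0 : ∀ e m → rhs e 0 m ≡ oneₛ 0 m
rhs-n=0 e m = ℚ.+-identityʳ (oneₛ 0 m)

rhs-off-support : ∀ e n m → ¬ OnSupport n m → rhs e n m ≡ 0ℚ
rhs-off-support e n m off = trans (cong₂ _+_ (oneₛ-off n m off) (sumTo-zero n (λ {k} _ → rhsTerm≡0 e n m k λ 3k<n m≡n∸3k →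
    ⊥-elim (off (k , trans (sym (ℕ.m∸n+n≡m (ℕ.<⇒≤ 3k<n))) (cong (ℕ._+ 3 ℕ.* k) (sym m≡n∸3k)))))))
  (ℚ.+-identityʳ 0ℚ)
  where
  oneₛ-off : ∀ n m → ¬ OnSupport n m → oneₛ n m ≡ 0ℚ
  oneₛ-off zero    zero    off = ⊥-elim (off (0 , refl))
  oneₛ-off zero    (suc m) _   = refl
  oneₛ-off (suc n) m       _   = refl

rhs-on-support : ∀ e m k → rhs e (suc m ℕ.+ 3 ℕ.* k) (suc m) ≡ coeff e m k
rhs-on-support e m k = begin
  0ℚ + sumTo n (rhsTerm e n (suc m))
    ≡⟨ ℚ.+-identityˡ _ ⟩
  sumTo n (rhsTerm e n (suc m))
    ≡⟨ sumTo-single n k k≤n other-terms ⟩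
  rhsTerm e n (suc m) k
    ≡⟨ rhsTerm-on-diagonal e n (suc m) k 3k<n (sym n∸3k≡1+m) ⟩
  frac e (n ∸ k ℕ.+ e) * ℕ→ℚ (((n ∸ 2 ℕ.* k) ∸ 1) C k) * ℕ→ℚ ((((2 ℕ.* n ∸ 4 ℕ.* k) ℕ.+ e) ∸ 1) C (n ∸ 3 ℕ.* k))
    ≡⟨ cong₂ (λ a b → frac e (a ℕ.+ e) * ℕ→ℚ ((b ∸ 1) C k) * ℕ→ℚ ((((2 ℕ.* n ∸ 4 ℕ.* k) ℕ.+ e) ∸ 1) C (n ∸ 3 ℕ.* k)))
             n∸k≡1+m+2k n∸2k≡1+m+k ⟩
  frac e (weight e m k) * ℕ→ℚ (lower m k) * ℕ→ℚ ((((2 ℕ.* n ∸ 4 ℕ.* k) ℕ.+ e) ∸ 1) C (n ∸ 3 ℕ.* k))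
    ≡⟨ cong₂ (λ a b → frac e (weight e m k) * ℕ→ℚ (lower m k) * ℕ→ℚ (a C b)) [2n∸4k+e]∸1≡top n∸3k≡1+m ⟩
  frac e (weight e m k) * ℕ→ℚ (lower m k) * ℕ→ℚ (top e m k C suc m)
    ≡⟨ ℚ.*-assoc (frac e (weight e m k)) _ _ ⟩
  frac e (weight e m k) * (ℕ→ℚ (lower m k) * ℕ→ℚ (top e m k C suc m))
    ≡⟨ [1+d]*y≡a*x⇒frac*x≡y e (m ℕ.+ (k ℕ.+ k) ℕ.+ e) (weight*coeff≡e*lower*C[top,1+m] e m k) ⟩
  coeff e m k ∎
  where
  open ≡-Reasoning
  open ℕ-Solver
  n = suc m ℕ.+ 3 ℕ.* k
  ∸-≡ : ∀ {a} b c → a ≡ b ℕ.+ c → a ∸ c ≡ b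
  ∸-≡ b c a≡b+c = trans (cong (_∸ c) a≡b+c) (ℕ.m+n∸n≡m b c)
  n∸k≡1+m+2k : n ∸ k ≡ suc m ℕ.+ (k ℕ.+ k)
  n∸k≡1+m+2k = ∸-≡ _ k (solve 2 (λ m k → (con 1 :+ m) :+ con 3 :* k := (con 1 :+ m) :+ (k :+ k) :+ k) refl m k)
  n∸2k≡1+m+k : n ∸ 2 ℕ.* k ≡ suc (m ℕ.+ k)
  n∸2k≡1+m+k = ∸-≡ _ (2 ℕ.* k) (solve 2 (λ m k → (con 1 :+ m) :+ con 3 :* k := (con 1 :+ (m :+ k)) :+ con 2 :* k) refl m k)
  2n∸4k≡2+2m+2k : 2 ℕ.* n ∸ 4 ℕ.* k ≡ suc (suc (m ℕ.+ m ℕ.+ (k ℕ.+ k)))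
  2n∸4k≡2+2m+2k = ∸-≡ _ (4 ℕ.* k)
    (solve 2 (λ m k → con 2 :* ((con 1 :+ m) :+ con 3 :* k) := (con 2 :+ (m :+ m :+ (k :+ k))) :+ con 4 :* k) refl m k)
  [2n∸4k+e]∸1≡top : (2 ℕ.* n ∸ 4 ℕ.* k ℕ.+ e) ∸ 1 ≡ top e m k
  [2n∸4k+e]∸1≡top = trans (cong (λ a → (a ℕ.+ e) ∸ 1) 2n∸4k≡2+2m+2k)
    (solve 3 (λ e m k → con 1 :+ (m :+ m :+ (k :+ k)) :+ e := con 1 :+ (e :+ (m :+ m) :+ (k :+ k))) refl e m k)
  n∸3k≡1+m : n ∸ 3 ℕ.* k ≡ suc m
  n∸3k≡1+m = ℕ.m+n∸n≡m (suc m) (3 ℕ.* k)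
  k≤n : k ℕ.≤ n
  k≤n = ℕ.≤-trans (ℕ.m≤n*m k 3) (ℕ.m≤n+m (3 ℕ.* k) (suc m))
  3k<n : 3 ℕ.* k ℕ.< n
  3k<n = s≤s (ℕ.m≤n+m (3 ℕ.* k) m)
  other-terms : ∀ {i} → i ℕ.≤ n → i ≢ k → rhsTerm e n (suc m) i ≡ 0ℚ
  other-terms {i} _ i≢k = rhsTerm≡0 e n (suc m) i λ 3i<n 1+m≡n∸3i → ⊥-elim (i≢k
    (ℕ.*-cancelˡ-≡ i k 3 (ℕ.+-cancelˡ-≡ (suc m) _ _
      (trans (cong (ℕ._+ 3 ℕ.* i) 1+m≡n∸3i) (ℕ.m∸n+n≡m (ℕ.<⇒≤ 3i<n))))))

rhs-at-support : ∀ e m k → rhs e (m ℕ.+ 3 ℕ.* k) m ≡ coeff₀ e m k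
rhs-at-support e zero    zero    = rhs-n=0 e 0
rhs-at-support e zero    (suc k) = rhs-m=0 e (3 ℕ.* suc k)
rhs-at-support e (suc m) k       = rhs-on-support e m k

-- The series that power-suc forces in the place of P^(f+2) Q.
rhsΔ : ℕ → Series
rhsΔ f n m = rhs (suc f) (suc n) (suc m) - rhs f (suc n) (suc m)

rhsΔ-on-support : ∀ f m k → rhsΔ f (m ℕ.+ 3 ℕ.* k) m ≡ coeffΔ f m k
rhsΔ-on-support f m k = cong₂ _-_ (rhs-on-support (suc f) m k) (rhs-on-support f m k)

rhsΔ-off-support : ∀ f n m → ¬ OnSupport n m → rhsΔ f n m ≡ 0ℚ
rhsΔ-off-support f n m off = cong₂ _-_ (rhs-off-support (suc f) (suc n) (suc m) off′) (rhs-off-support f (suc n) (suc m) off′)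
  where
  off′ : ¬ OnSupport (suc n) (suc m)
  off′ (k , 1+n≡1+m+3k) = off (k , ℕ.suc-injective 1+n≡1+m+3k)

z³-shift-rhsΔ-on-support : ∀ g m k → z³-shift (rhsΔ g) (m ℕ.+ 3 ℕ.* k) m ≡ coeffΔ↓ g m k
z³-shift-rhsΔ-on-support g m zero = trans (cong (λ n → z³-shift (rhsΔ g) n m) (ℕ.+-identityʳ m)) (vanishes-on-diagonal m)
  where
  vanishes-on-diagonal : ∀ m → z³-shift (rhsΔ g) m m ≡ 0ℚ
  vanishes-on-diagonal 0 = refl
  vanishes-on-diagonal 1 = refl
  vanishes-on-diagonal 2 = refl
  vanishes-on-diagonal (suc (suc (suc m))) = rhsΔ-off-support g m (3 ℕ.+ m) λ (k , m≡3+m+3k) →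
    ℕ.<-irrefl m≡3+m+3k (ℕ.≤-trans (ℕ.m<n+m m {3} (s≤s z≤n)) (ℕ.m≤m+n (3 ℕ.+ m) (3 ℕ.* k)))
z³-shift-rhsΔ-on-support g m (suc k) =
  trans (cong (λ n → z³-shift (rhsΔ g) n m) (m+3[1+k]≡3+m+3k m k)) (rhsΔ-on-support g m k)

z³-shift-rhsΔ-off-support : ∀ g n m → ¬ OnSupport n m → z³-shift (rhsΔ g) n m ≡ 0ℚ
z³-shift-rhsΔ-off-support g 0 m _ = refl
z³-shift-rhsΔ-off-support g 1 m _ = refl
z³-shift-rhsΔ-off-support g 2 m _ = refl
z³-shift-rhsΔ-off-support g (suc (suc (suc n))) m off = rhsΔ-off-support g n m λ (k , n≡m+3k) →
  off (suc k , trans (cong (3 ℕ.+_) n≡m+3k) (sym (m+3[1+k]≡3+m+3k m k)))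

rhs-satisfies-recurrences : SatisfiesRecurrences rhs rhsΔ
rhs-satisfies-recurrences = record
  { power-zero = rhs-e=0
  ; power-suc  = power-suc
  ; companion  = companion
  }
  where
  power-suc : ∀ e → rhs (suc e) ≈ₛ rhs e +ₛ z-shift (w-shift (rhsΔ e))
  power-suc e zero m =
    trans (rhs-n=0 (suc e) m) (trans (sym (rhs-n=0 e m)) (sym (ℚ.+-identityʳ (rhs e 0 m))))
  power-suc e (suc n) zero =
    trans (rhs-m=0 (suc e) (suc n)) (trans (sym (rhs-m=0 e (suc n))) (sym (ℚ.+-identityʳ (rhs e (suc n) 0))))
  power-suc e (suc n) (suc m) =
    solve 2 (λ x y → x := y :+ (x :- y)) refl (rhs (suc e) (suc n) (suc m)) (rhs e (suc n) (suc m))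
    where open ℚ-Solver
  companion : ∀ f → rhsΔ f ≈ₛ rhs (2 ℕ.+ f) +ₛ z³-shift (rhsΔ (2 ℕ.+ f))
  companion f n m with onSupport? n m
  ... | yes (k , refl) = begin
    rhsΔ f (m ℕ.+ 3 ℕ.* k) m                     ≡⟨ rhsΔ-on-support f m k ⟩
    coeffΔ f m k                                 ≡⟨ coeffΔ-recurrence f m k ⟩
    coeff₀ (2 ℕ.+ f) m k + coeffΔ↓ (2 ℕ.+ f) m k ≡⟨ cong₂ _+_ (rhs-at-support (2 ℕ.+ f) m k)
                                                              (z³-shift-rhsΔ-on-support (2 ℕ.+ f) m k) ⟨
    rhs (2 ℕ.+ f) (m ℕ.+ 3 ℕ.* k) m + z³-shift (rhsΔ (2 ℕ.+ f)) (m ℕ.+ 3 ℕ.* k) m ∎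
    where open ≡-Reasoning
  ... | no off = trans (rhsΔ-off-support f n m off)
    (sym (cong₂ _+_ (rhs-off-support (2 ℕ.+ f) n m off) (z³-shift-rhsΔ-off-support (2 ℕ.+ f) n m off)))

lemma4p3 : (P Q : Series)
           → Q *ₛ (oneₛ -ₛ zₛ ^ₛ 3 *ₛ P ^ₛ 2) ≈ₛ oneₛ
           → P ≈ₛ oneₛ +ₛ wₛ *ₛ zₛ *ₛ P ^ₛ 2 *ₛ Q
           → (e : ℕ) → .{{_ : NonZero e}}
           → P ^ₛ e ≈ₛ rhs e
lemma4p3 P Q Q-inverse P-equation e =
  recurrences-unique (powers-satisfy-recurrences P Q Q-inverse P-equation) rhs-satisfies-recurrences e
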